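{- Let $q$ be an odd prime power with $q \equiv 1 \pmod 4$. For any integer $n \geq 5$ and any $a_1, \ldots, a_n \in F_q^{\ast}$, there exist points $A_1, \ldots, A_n \in F_q^2$ (a polygon $A_1 \ldots A_n$) such that $Q(A_i, A_{i+1}) = a_i$ for all $i \in \{1,\ldots,n\}$, where $A_{n+1} = A_1$.
   Context: $F_q$ is the finite field with $q$ elements and $F_q^{\ast}$ its nonzero elements; the quadrance of $[x_1,y_1],[x_2,y_2] \in F_q^2$ is $Q = (x_2-x_1)^2 + (y_2-y_1)^2$. -}

module Defs where

open import Level using (Level; _⊔_)
open import Algebra.Bundles using (CommutativeRing)
open import Data.Nat using (ℕ; zero; suc; _≤_; _^_; _%_; s≤s)
open import Data.Nat.Primality using (Prime)
open import Data.Fin using (Fin; zero; suc; toℕ; fromℕ<)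
open import Data.Product using (Σ; ∃; _×_; _,_)
open import Relation.Nullary using (¬_; yes; no)
open import Relation.Binary.PropositionalEquality using (_≡_)
import Data.Nat as ℕ

IsPrimePower : ℕ → Set
IsPrimePower q = Σ ℕ λ p → Σ ℕ λ k → Prime p × 1 ≤ k × q ≡ p ^ k

module _ {c ℓ : Level} (R : CommutativeRing c ℓ) where
  open CommutativeRing R

  record IsField : Set (c ⊔ ℓ) where
    field
      0≉1     : ¬ (0# ≈ 1#)
      inverse : ∀ x → ¬ (x ≈ 0#) → ∃ λ y → x * y ≈ 1#

  record HasSize (q : ℕ) : Set (c ⊔ ℓ) where
    field
      enum       : Fin q → Carrier
      injective  : ∀ i j → enum i ≈ enum j → i ≡ j
      surjective : ∀ x → ∃ λ i → enum i ≈ x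

  Point : Set c
  Point = Carrier × Carrier

  quadrance : Point → Point → Carrier
  quadrance (x₁ , y₁) (x₂ , y₂) =
    ((x₂ - x₁) * (x₂ - x₁)) + ((y₂ - y₁) * (y₂ - y₁))

next : ∀ {n} → Fin n → Fin n
next {suc m} i with toℕ i ℕ.<? m
... | yes p = fromℕ< (s≤s p)
... | no _  = zero

{-# OPTIONS --safe #-}
-- In null coordinates d = x + i y, e = x - i y (available because 2 is invertible and -1 is
-- a square in F) a side has quadrance d e, so it suffices to find d_k e_k = a_k with
-- Σ d_k = Σ e_k = 0.  If the a_k are not all equal, put two different ones x ≠ y first:
-- the sides (t , x / t), (-t , -y / t) contribute (0 , (x - y) / t), and the other n - 2 ≥ 3
-- sides can be chosen with Σ d = 0 and Σ e ≠ 0 (one of three explicit choices works), so a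
-- suitable t closes the polygon.  If all a_k are equal, rescale a solution of
-- Σ z = Σ z⁻¹ = 0 built from pairs (1 , -1) and one explicit quintuple.
-- The square root of -1 comes from Wilson's theorem: pairing x with -1/x shows that without
-- one the product of all nonzero elements would be (-1)^((q-1)/2) = 1 rather than -1.
module Submission where

open import Level using (Level; _⊔_)
open import Algebra.Bundles using (CommutativeMonoid; CommutativeRing; AbelianGroup)
open import Algebra.Solver.Ring.AlmostCommutativeRing using (fromCommutativeRing; _-Raw-AlmostCommutative⟶_)
import Algebra.Solver.CommutativeMonoid
open import Data.Bool using (Bool; true; false; if_then_else_)
open import Data.Nat as ℕ using (ℕ; zero; suc; _≤_; s≤s; _%_)
import Data.Nat.Properties as ℕ
open import Data.Nat.DivMod using (m*n%n≡0; %-remove-+ˡ)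
open import Data.Nat.Divisibility using (divides-refl)
open import Data.Integer as ℤ using (ℤ; +_; -[1+_]; _⊖_)
import Data.Integer.Properties as ℤ
open import Data.Fin as Fin using (Fin; zero; suc; toℕ; inject₁; fromℕ; fromℕ<)
import Data.Fin.Properties as Fin
open import Data.Fin.Permutation using (permutation)
open import Data.List using (List; []; _∷_; _++_; [_]; replicate; length; tabulate)
import Data.List.Properties as List
open import Data.List.Relation.Unary.All as All using (All; []; _∷_)
import Data.List.Relation.Unary.All.Properties as All
open import Data.List.Relation.Binary.Permutation.Propositional as ↭
  using (_↭_; ↭-refl; ↭-trans; ↭-prep; ↭-swap)
import Data.List.Relation.Binary.Permutation.Propositional.Properties as ↭
open import Data.Maybe using (Maybe; just; nothing)
open import Data.Product using (∃; ∃₂; _,_; proj₁; proj₂)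
open import Data.Sum as Sum using (_⊎_; inj₁; inj₂)
import Data.Vec.Functional as Vector
open import Function using (_∘_)
open import Relation.Binary.Definitions using (Decidable; Tri; tri<; tri≈; tri>)
open import Relation.Nullary using (¬_; Dec; does; yes; no; contradiction)
import Relation.Nullary.Decidable as Dec
open import Relation.Binary.PropositionalEquality as ≡ using (_≡_; _≢_)
open import Defs

module RingSolver {c ℓ : Level} (R : CommutativeRing c ℓ) where
  open CommutativeRing R
  open import Algebra.Properties.Ring ring
    using (-‿involutive; -‿distribˡ-*; -‿distribʳ-*; -‿+-comm; -0#≈0#)
  open import Algebra.Properties.Semiring.Mult.TCOptimised semiring using (_×_; ×-homo-+; ×1-homo-*; 1+×)
  open import Relation.Binary.Reasoning.Setoid setoid

  fromℤ : ℤ → Carrier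
  fromℤ (+ n)    = n × 1#
  fromℤ -[1+ n ] = - (suc n × 1#)

  fromℤ-⊖ : ∀ m n → fromℤ (m ⊖ n) ≈ m × 1# - n × 1#
  fromℤ-⊖ zero    zero    = sym (-‿inverseʳ 0#)
  fromℤ-⊖ (suc m) zero    = sym (trans (+-congˡ -0#≈0#) (+-identityʳ _))
  fromℤ-⊖ zero    (suc n) = sym (+-identityˡ _)
  fromℤ-⊖ (suc m) (suc n) = begin
    fromℤ (suc m ⊖ suc n)               ≡⟨ ≡.cong fromℤ (ℤ.[1+m]⊖[1+n]≡m⊖n m n) ⟩
    fromℤ (m ⊖ n)                       ≈⟨ fromℤ-⊖ m n ⟩
    m × 1# - n × 1#                     ≈⟨ +-identityˡ _ ⟨
    0# + (m × 1# - n × 1#)              ≈⟨ +-congʳ (-‿inverseʳ 1#) ⟨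
    (1# - 1#) + (m × 1# - n × 1#)       ≈⟨ interchange 1# (- 1#) (m × 1#) (- (n × 1#)) ⟩
    (1# + m × 1#) + (- 1# - (n × 1#))   ≈⟨ +-congˡ (-‿+-comm 1# (n × 1#)) ⟩
    (1# + m × 1#) - (1# + n × 1#)       ≈⟨ +-cong (1+× m 1#) (-‿cong (1+× n 1#)) ⟨
    suc m × 1# - suc n × 1#             ∎
    where
    open Algebra.Solver.CommutativeMonoid +-commutativeMonoid using (solve; _⊕_; _⊜_)
    interchange : ∀ a b c d → (a + b) + (c + d) ≈ (a + c) + (b + d)
    interchange = solve 4 (λ a b c d → (a ⊕ b) ⊕ (c ⊕ d) ⊜ (a ⊕ c) ⊕ (b ⊕ d)) refl

  fromℤ-neg : ∀ i → fromℤ (ℤ.- i) ≈ - fromℤ i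
  fromℤ-neg (+ zero)  = sym -0#≈0#
  fromℤ-neg (+ suc n) = refl
  fromℤ-neg -[1+ n ]  = sym (-‿involutive _)

  fromℤ-+ : ∀ i j → fromℤ (i ℤ.+ j) ≈ fromℤ i + fromℤ j
  fromℤ-+ (+ m)    (+ n)    = ×-homo-+ 1# m n
  fromℤ-+ (+ m)    -[1+ n ] = fromℤ-⊖ m (suc n)
  fromℤ-+ -[1+ m ] (+ n)    = trans (fromℤ-⊖ n (suc m)) (+-comm _ _)
  fromℤ-+ -[1+ m ] -[1+ n ] = begin
    - (suc (suc (m ℕ.+ n)) × 1#)      ≡⟨ ≡.cong (λ k → - (suc k × 1#)) (ℕ.+-suc m n) ⟨
    - ((suc m ℕ.+ suc n) × 1#)        ≈⟨ -‿cong (×-homo-+ 1# (suc m) (suc n)) ⟩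
    - (suc m × 1# + suc n × 1#)       ≈⟨ -‿+-comm _ _ ⟨
    - (suc m × 1#) + - (suc n × 1#)   ∎

  fromℤ-+* : ∀ m j → fromℤ (+ m ℤ.* j) ≈ m × 1# * fromℤ j
  fromℤ-+* m (+ n)    = trans (reflexive (≡.cong fromℤ (≡.sym (ℤ.pos-* m n)))) (×1-homo-* m n)
  fromℤ-+* m -[1+ n ] = begin
    fromℤ (+ m ℤ.* ℤ.- (+ suc n))   ≡⟨ ≡.cong fromℤ (ℤ.neg-distribʳ-* (+ m) (+ suc n)) ⟨
    fromℤ (ℤ.- (+ m ℤ.* + suc n))   ≈⟨ fromℤ-neg (+ m ℤ.* + suc n) ⟩
    - fromℤ (+ m ℤ.* + suc n)       ≈⟨ -‿cong (fromℤ-+* m (+ suc n)) ⟩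
    - (m × 1# * fromℤ (+ suc n))    ≈⟨ -‿distribʳ-* _ _ ⟩
    m × 1# * fromℤ -[1+ n ]         ∎

  fromℤ-* : ∀ i j → fromℤ (i ℤ.* j) ≈ fromℤ i * fromℤ j
  fromℤ-* (+ m)    j = fromℤ-+* m j
  fromℤ-* -[1+ m ] j = begin
    fromℤ (ℤ.- (+ suc m) ℤ.* j)   ≡⟨ ≡.cong fromℤ (ℤ.neg-distribˡ-* (+ suc m) j) ⟨
    fromℤ (ℤ.- (+ suc m ℤ.* j))   ≈⟨ fromℤ-neg (+ suc m ℤ.* j) ⟩
    - fromℤ (+ suc m ℤ.* j)       ≈⟨ -‿cong (fromℤ-+* (suc m) j) ⟩
    - (suc m × 1# * fromℤ j)      ≈⟨ -‿distribˡ-* _ _ ⟩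
    fromℤ -[1+ m ] * fromℤ j      ∎

  ℤ⟶R : ℤ.+-*-rawRing -Raw-AlmostCommutative⟶ fromCommutativeRing R
  ℤ⟶R = record
    { ⟦_⟧ = fromℤ ; +-homo = fromℤ-+ ; *-homo = fromℤ-* ; -‿homo = fromℤ-neg
    ; 0-homo = refl ; 1-homo = refl
    }

  fromℤ-≟ : ∀ i j → Maybe (fromℤ i ≈ fromℤ j)
  fromℤ-≟ i j with i ℤ.≟ j
  ... | yes ≡.refl = just refl
  ... | no _       = nothing

  open import Algebra.Solver.Ring ℤ.+-*-rawRing (fromCommutativeRing R) ℤ⟶R fromℤ-≟ public

  κ : ∀ {m} → ℕ → Polynomial m
  κ n = con (+ n)

count : ∀ {n} → (Fin n → Bool) → ℕ
count b = sum (λ i → if b i then 1 else 0)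
  where open import Algebra.Properties.CommutativeMonoid.Sum ℕ.+-0-commutativeMonoid using (sum)

module Selection {a ℓ : Level} (M : CommutativeMonoid a ℓ) where
  open CommutativeMonoid M
  open import Algebra.Properties.CommutativeMonoid.Sum M public
  open import Algebra.Properties.Monoid.Mult monoid public using (_×_)

  when : Bool → Carrier → Carrier
  when b x = if b then x else ε

  when-∙ : ∀ b x y → when b x ∙ when b y ≈ when b (x ∙ y)
  when-∙ true  x y = refl
  when-∙ false x y = identityˡ ε

  when-ε : ∀ b → when b ε ≈ ε
  when-ε true  = refl
  when-ε false = refl

  when-yes : ∀ {p} {P : Set p} (p? : Dec P) → P → ∀ x → when (does p?) x ≈ x
  when-yes (yes _) _ x = refl
  when-yes (no ¬p) p x = contradiction p ¬p

  when-no : ∀ {p} {P : Set p} (p? : Dec P) → ¬ P → ∀ x → when (does p?) x ≈ ε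
  when-no (yes p) ¬p x = contradiction p ¬p
  when-no (no _)  _  x = refl

  when-cong : ∀ {p} {P : Set p} (p? : Dec P) {x y} → (P → x ≈ y) → when (does p?) x ≈ when (does p?) y
  when-cong (yes p) x≈y = x≈y p
  when-cong (no _)  _   = refl

  sum-when : ∀ {n} (b : Fin n → Bool) x → sum (λ i → when (b i) x) ≈ count b × x
  sum-when {zero}  b x = refl
  sum-when {suc n} b x with b zero
  ... | true  = ∙-congˡ (sum-when (b ∘ suc) x)
  ... | false = trans (identityˡ _) (sum-when (b ∘ suc) x)

  sum-when-≟ : ∀ {n} (j : Fin n) x → sum (λ i → when (does (i Fin.≟ j)) x) ≈ x
  sum-when-≟ {suc n} zero    x = trans (∙-congˡ (sum-replicate-zero n)) (identityʳ x)
  sum-when-≟ {suc n} (suc j) x = trans (identityˡ _) (sum-when-≟ j x)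

module Involution {n : ℕ} (ι : Fin n → Fin n) (ι-involutive : ∀ i → ι (ι i) ≡ i) where

  leads fixed : Fin n → Bool
  leads i = does (i Fin.<? ι i)
  fixed i = does (i Fin.≟ ι i)

  module _ {a ℓ : Level} (M : CommutativeMonoid a ℓ) where
    open CommutativeMonoid M
    open Selection M
    open import Relation.Binary.Reasoning.Setoid setoid

    private
      trails : Fin n → Bool
      trails i = does (ι i Fin.<? i)

      partition : ∀ {A B C : Set} (a? : Dec A) (b? : Dec B) (c? : Dec C) → Tri A B C →
                  ∀ x → x ≈ when (does a?) x ∙ (when (does c?) x ∙ when (does b?) x)
      partition a? b? c? (tri< a ¬b ¬c) x = sym (begin
        when (does a?) x ∙ (when (does c?) x ∙ when (does b?) x)
          ≈⟨ ∙-cong (when-yes a? a x) (∙-cong (when-no c? ¬c x) (when-no b? ¬b x)) ⟩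
        x ∙ (ε ∙ ε)  ≈⟨ trans (∙-congˡ (identityˡ ε)) (identityʳ x) ⟩
        x            ∎)
      partition a? b? c? (tri≈ ¬a b ¬c) x = sym (begin
        when (does a?) x ∙ (when (does c?) x ∙ when (does b?) x)
          ≈⟨ ∙-cong (when-no a? ¬a x) (∙-cong (when-no c? ¬c x) (when-yes b? b x)) ⟩
        ε ∙ (ε ∙ x)  ≈⟨ trans (identityˡ _) (identityˡ x) ⟩
        x            ∎)
      partition a? b? c? (tri> ¬a ¬b c) x = sym (begin
        when (does a?) x ∙ (when (does c?) x ∙ when (does b?) x)
          ≈⟨ ∙-cong (when-no a? ¬a x) (∙-cong (when-yes c? c x) (when-no b? ¬b x)) ⟩
        ε ∙ (x ∙ ε)  ≈⟨ trans (identityˡ _) (identityʳ x) ⟩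
        x            ∎)

      split : ∀ (f : Fin n → Carrier) i →
              f i ≈ when (leads i) (f i) ∙ (when (trails i) (f i) ∙ when (fixed i) (f i))
      split f i = partition (i Fin.<? ι i) (i Fin.≟ ι i) (ι i Fin.<? i) (Fin.<-cmp i (ι i)) (f i)

      sum-trails : ∀ (f : Fin n → Carrier) →
                   sum (λ i → when (trails i) (f i)) ≈ sum (λ i → when (leads i) (f (ι i)))
      sum-trails f = trans (∑-permute _ (permutation ι ι ι-involutive ι-involutive))
        (reflexive (sum-cong-≗ λ i → ≡.cong (λ k → when (does (k Fin.<? ι i)) (f (ι i))) (ι-involutive i)))

    sum-involution : ∀ (f : Fin n → Carrier) →
                     sum f ≈ sum (λ i → when (leads i) (f i ∙ f (ι i))) ∙ sum (λ i → when (fixed i) (f i))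
    sum-involution f = begin
      sum f                                  ≈⟨ sum-cong-≋ (split f) ⟩
      sum (λ i → L i ∙ (T i ∙ X i))          ≈⟨ ∑-distrib-+ L _ ⟩
      sum L ∙ sum (λ i → T i ∙ X i)          ≈⟨ ∙-congˡ (∑-distrib-+ T X) ⟩
      sum L ∙ (sum T ∙ sum X)                ≈⟨ assoc _ _ _ ⟨
      (sum L ∙ sum T) ∙ sum X                ≈⟨ ∙-congʳ (∙-congˡ (sum-trails f)) ⟩
      (sum L ∙ sum T′) ∙ sum X               ≈⟨ ∙-congʳ (∑-distrib-+ L T′) ⟨
      sum (λ i → L i ∙ T′ i) ∙ sum X         ≈⟨ ∙-congʳ (sum-cong-≋ λ i → when-∙ (leads i) _ _) ⟩
      sum (λ i → when (leads i) (f i ∙ f (ι i))) ∙ sum X  ∎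
      where
      L T T′ X : Fin n → Carrier
      L i  = when (leads i) (f i)
      T i  = when (trails i) (f i)
      T′ i = when (leads i) (f (ι i))
      X i  = when (fixed i) (f i)

  card-involution : n ≡ count leads ℕ.* 2 ℕ.+ count fixed
  card-involution = begin
    n                                              ≡⟨ sum-ones n ⟨
    sum {n} (λ _ → 1)                              ≡⟨ sum-involution ℕ.+-0-commutativeMonoid (λ _ → 1) ⟩
    sum (λ i → when (leads i) 2) ℕ.+ count fixed   ≡⟨ ≡.cong (ℕ._+ count fixed) (sum-when leads 2) ⟩
    count leads × 2 ℕ.+ count fixed                ≡⟨ ≡.cong (ℕ._+ count fixed) (×≡* (count leads) 2) ⟩
    count leads ℕ.* 2 ℕ.+ count fixed              ∎
    where
    open Selection ℕ.+-0-commutativeMonoid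
    open ≡.≡-Reasoning

    sum-ones : ∀ m → sum {m} (λ _ → 1) ≡ m
    sum-ones zero    = ≡.refl
    sum-ones (suc m) = ≡.cong suc (sum-ones m)

    ×≡* : ∀ m k → m × k ≡ m ℕ.* k
    ×≡* zero    k = ≡.refl
    ×≡* (suc m) k = ≡.cong (k ℕ.+_) (×≡* m k)

module FiniteField {c ℓ : Level} (F : CommutativeRing c ℓ) (isField : IsField F) {q : ℕ} (size : HasSize F q) where
  open CommutativeRing F
  open IsField isField
  open HasSize size
  open RingSolver F
  open import Relation.Binary.Reasoning.Setoid setoid
  open import Algebra.Properties.Ring ring using (-‿involutive; -0#≈0#)
  open import Algebra.Properties.Group +-group using (x∙y⁻¹≈ε⇒x≈y; inverseˡ-unique)

  module Π = Selection *-commutativeMonoid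
  module Σℕ = Selection ℕ.+-0-commutativeMonoid

  index : Carrier → Fin q
  index x = proj₁ (surjective x)

  enum-index : ∀ x → enum (index x) ≈ x
  enum-index x = proj₂ (surjective x)

  enum-index≡ : ∀ {i x} → i ≡ index x → enum i ≈ x
  enum-index≡ {i} {x} i≡ = trans (reflexive (≡.cong enum i≡)) (enum-index x)

  index-cong : ∀ {x y} → x ≈ y → index x ≡ index y
  index-cong {x} {y} x≈y = injective _ _ (trans (enum-index x) (trans x≈y (sym (enum-index y))))

  index-enum : ∀ i → index (enum i) ≡ i
  index-enum i = injective _ _ (enum-index (enum i))

  infix 4 _≟_
  _≟_ : Decidable _≈_
  x ≟ y = Dec.map′ index-injective index-cong (index x Fin.≟ index y)
    where
    index-injective : index x ≡ index y → x ≈ y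
    index-injective eq = trans (sym (enum-index x)) (enum-index≡ eq)

  module Transport (g : Carrier → Carrier) (g-cong : ∀ {x y} → x ≈ y → g x ≈ g y)
                   (g-involutive : ∀ x → g (g x) ≈ x) where
    ι : Fin q → Fin q
    ι i = index (g (enum i))

    enum-ι : ∀ i → enum (ι i) ≈ g (enum i)
    enum-ι i = enum-index _

    ι-involutive : ∀ i → ι (ι i) ≡ i
    ι-involutive i = ≡.trans (index-cong (trans (g-cong (enum-ι i)) (g-involutive (enum i)))) (index-enum i)

    open Involution ι ι-involutive public

    unmoved : ∀ {i} → i ≡ ι i → g (enum i) ≈ enum i
    unmoved {i} i≡ιi = trans (sym (enum-ι i)) (reflexive (≡.cong enum (≡.sym i≡ιi)))

    fixes : ∀ {i} → g (enum i) ≈ enum i → i ≡ ι i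
    fixes {i} gx≈x = ≡.trans (≡.sym (index-enum i)) (index-cong (sym gx≈x))

  1≉0 : 1# ≉ 0#
  1≉0 = 0≉1 ∘ sym

  -- If 2 = 0 then x ↦ x + 1 is a fixed-point-free involution, so q would be even.
  two≉0 : q % 2 ≡ 1 → 1# + 1# ≉ 0#
  two≉0 q-odd 2≈0 = contradiction (≡.trans (≡.sym q-odd) q-even) λ ()
    where
    shift-involutive : ∀ x → (x + 1#) + 1# ≈ x
    shift-involutive x = trans (+-assoc x 1# 1#) (trans (+-congˡ 2≈0) (+-identityʳ x))

    open Transport (_+ 1#) +-congʳ shift-involutive

    shift-moves : ∀ x → x + 1# ≉ x
    shift-moves x x+1≈x = 1≉0 (begin
      1#              ≈⟨ solve 2 (λ x o → o := (x :+ o) :- x) refl x 1# ⟩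
      (x + 1#) - x    ≈⟨ +-congʳ x+1≈x ⟩
      x - x           ≈⟨ -‿inverseʳ x ⟩
      0#              ∎)

    no-fixed-points : count fixed ≡ 0
    no-fixed-points = ≡.trans (Σℕ.sum-cong-≋ λ i → Σℕ.when-no (i Fin.≟ ι i) (shift-moves _ ∘ unmoved) 1)
                              (Σℕ.sum-replicate-zero q)

    q-even : q % 2 ≡ 0
    q-even = ≡.trans (≡.cong (_% 2) (≡.trans card-involution (≡.cong (count leads ℕ.* 2 ℕ.+_) no-fixed-points)))
                     (≡.trans (≡.cong (_% 2) (ℕ.+-identityʳ (count leads ℕ.* 2))) (m*n%n≡0 (count leads) 2))

  _⁻¹ : Carrier → Carrier
  x ⁻¹ with x ≟ 0#
  ... | yes _  = 0#
  ... | no x≉0 = proj₁ (inverse x x≉0)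

  ⁻¹-inverse : ∀ {x} → x ≉ 0# → x * x ⁻¹ ≈ 1#
  ⁻¹-inverse {x} x≉0 with x ≟ 0#
  ... | yes x≈0 = contradiction x≈0 x≉0
  ... | no x≉0′ = proj₂ (inverse x x≉0′)

  ⁻¹-zero : ∀ {x} → x ≈ 0# → x ⁻¹ ≈ 0#
  ⁻¹-zero {x} x≈0 with x ≟ 0#
  ... | yes _  = refl
  ... | no x≉0 = contradiction x≈0 x≉0

  nonzero-factorˡ : ∀ {x y} → x * y ≈ 1# → x ≉ 0#
  nonzero-factorˡ {x} {y} xy≈1 x≈0 = 1≉0 (trans (sym xy≈1) (trans (*-congʳ x≈0) (zeroˡ y)))

  ⁻¹-unique : ∀ {x y} → x * y ≈ 1# → x ⁻¹ ≈ y
  ⁻¹-unique {x} {y} xy≈1 = begin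
    x ⁻¹              ≈⟨ *-identityʳ _ ⟨
    x ⁻¹ * 1#         ≈⟨ *-congˡ xy≈1 ⟨
    x ⁻¹ * (x * y)    ≈⟨ solve 3 (λ x x′ y → x′ :* (x :* y) := (x :* x′) :* y) refl x (x ⁻¹) y ⟩
    (x * x ⁻¹) * y    ≈⟨ *-congʳ (⁻¹-inverse (nonzero-factorˡ xy≈1)) ⟩
    1# * y            ≈⟨ *-identityˡ y ⟩
    y                 ∎

  ⁻¹-cong : ∀ {x y} → x ≈ y → x ⁻¹ ≈ y ⁻¹
  ⁻¹-cong {x} {y} x≈y = by-cases (y ≟ 0#)
    where
    by-cases : Dec (y ≈ 0#) → x ⁻¹ ≈ y ⁻¹
    by-cases (yes y≈0) = trans (⁻¹-zero (trans x≈y y≈0)) (sym (⁻¹-zero y≈0))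
    by-cases (no y≉0)  = ⁻¹-unique (trans (*-congʳ x≈y) (⁻¹-inverse y≉0))

  ⁻¹-nonzero : ∀ {x} → x ≉ 0# → x ⁻¹ ≉ 0#
  ⁻¹-nonzero {x} x≉0 x⁻¹≈0 = 1≉0 (trans (sym (⁻¹-inverse x≉0)) (trans (*-congˡ x⁻¹≈0) (zeroʳ x)))

  *-nonzero : ∀ {x y} → x ≉ 0# → y ≉ 0# → x * y ≉ 0#
  *-nonzero {x} {y} x≉0 y≉0 xy≈0 = y≉0 (begin
    y                  ≈⟨ *-identityˡ y ⟨
    1# * y             ≈⟨ *-congʳ (⁻¹-inverse x≉0) ⟨
    (x * x ⁻¹) * y     ≈⟨ solve 3 (λ x x′ y → (x :* x′) :* y := x′ :* (x :* y)) refl x (x ⁻¹) y ⟩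
    x ⁻¹ * (x * y)     ≈⟨ *-congˡ xy≈0 ⟩
    x ⁻¹ * 0#          ≈⟨ zeroʳ _ ⟩
    0#                 ∎)

  domain : ∀ {x y} → x * y ≈ 0# → x ≈ 0# ⊎ y ≈ 0#
  domain {x} {y} xy≈0 with x ≟ 0# | y ≟ 0#
  ... | yes x≈0 | _       = inj₁ x≈0
  ... | no _    | yes y≈0 = inj₂ y≈0
  ... | no x≉0  | no y≉0  = contradiction xy≈0 (*-nonzero x≉0 y≉0)

  -1≉0 : - 1# ≉ 0#
  -1≉0 -1≈0 = 1≉0 (trans (sym (-‿involutive 1#)) (trans (-‿cong -1≈0) -0#≈0#))

  -1*-1 : - 1# * - 1# ≈ 1#
  -1*-1 = solve 0 (:- κ 1 :* :- κ 1 := κ 1) refl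

  square-one : ∀ {x} → x * x ≈ 1# → x ≈ 1# ⊎ x ≈ - 1#
  square-one {x} xx≈1 = Sum.map (x∙y⁻¹≈ε⇒x≈y x 1#) (inverseˡ-unique x 1#) (domain product≈0)
    where
    product≈0 : (x - 1#) * (x + 1#) ≈ 0#
    product≈0 = begin
      (x - 1#) * (x + 1#)   ≈⟨ solve 1 (λ x → (x :- κ 1) :* (x :+ κ 1) := x :* x :- κ 1) refl x ⟩
      x * x - 1#            ≈⟨ +-congʳ xx≈1 ⟩
      1# - 1#               ≈⟨ -‿inverseʳ 1# ⟩
      0#                    ∎

  orOne : Carrier → Carrier
  orOne x with x ≟ 0#
  ... | yes _ = 1#
  ... | no _  = x

  orOne-zero : ∀ {x} → x ≈ 0# → orOne x ≈ 1#
  orOne-zero {x} x≈0 with x ≟ 0#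
  ... | yes _  = refl
  ... | no x≉0 = contradiction x≈0 x≉0

  orOne-nonzero : ∀ {x} → x ≉ 0# → orOne x ≈ x
  orOne-nonzero {x} x≉0 with x ≟ 0#
  ... | yes x≈0 = contradiction x≈0 x≉0
  ... | no _    = refl

  ∏nonzero : Carrier
  ∏nonzero = Π.sum (orOne ∘ enum)

  -- Pairing x with a / x: each pair contributes a, the fixed points are 0 and the square roots of a.
  module Reciprocal (a : Carrier) (a≉0 : a ≉ 0#) where
    g : Carrier → Carrier
    g x = a * x ⁻¹

    g-zero : ∀ {x} → x ≈ 0# → g x ≈ 0#
    g-zero x≈0 = trans (*-congˡ (⁻¹-zero x≈0)) (zeroʳ a)

    g-involutive : ∀ x → g (g x) ≈ x
    g-involutive x = by-cases (x ≟ 0#)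
      where
      [ax⁻¹]⁻¹ : x ≉ 0# → (a * x ⁻¹) ⁻¹ ≈ x * a ⁻¹
      [ax⁻¹]⁻¹ x≉0 = ⁻¹-unique (begin
        (a * x ⁻¹) * (x * a ⁻¹)   ≈⟨ solve 4 (λ a a′ x x′ → (a :* x′) :* (x :* a′) := (a :* a′) :* (x :* x′))
                                            refl a (a ⁻¹) x (x ⁻¹) ⟩
        (a * a ⁻¹) * (x * x ⁻¹)   ≈⟨ *-cong (⁻¹-inverse a≉0) (⁻¹-inverse x≉0) ⟩
        1# * 1#                   ≈⟨ *-identityˡ 1# ⟩
        1#                        ∎)

      by-cases : Dec (x ≈ 0#) → g (g x) ≈ x
      by-cases (yes x≈0) = trans (g-zero (g-zero x≈0)) (sym x≈0)
      by-cases (no x≉0)  = begin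
        a * (a * x ⁻¹) ⁻¹   ≈⟨ *-congˡ ([ax⁻¹]⁻¹ x≉0) ⟩
        a * (x * a ⁻¹)      ≈⟨ solve 3 (λ a a′ x → a :* (x :* a′) := (a :* a′) :* x) refl a (a ⁻¹) x ⟩
        (a * a ⁻¹) * x      ≈⟨ *-congʳ (⁻¹-inverse a≉0) ⟩
        1# * x              ≈⟨ *-identityˡ x ⟩
        x                   ∎

    open Transport g (λ x≈y → *-congˡ (⁻¹-cong x≈y)) g-involutive public

    root : ∀ {x} → x ≉ 0# → g x ≈ x → x * x ≈ a
    root {x} x≉0 gx≈x = begin
      x * x              ≈⟨ *-congʳ gx≈x ⟨
      (a * x ⁻¹) * x     ≈⟨ solve 3 (λ a x x′ → (a :* x′) :* x := a :* (x :* x′)) refl a x (x ⁻¹) ⟩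
      a * (x * x ⁻¹)     ≈⟨ *-congˡ (⁻¹-inverse x≉0) ⟩
      a * 1#             ≈⟨ *-identityʳ a ⟩
      a                  ∎

    pair-product : ∀ {i} → i ≢ ι i → orOne (enum i) * orOne (enum (ι i)) ≈ a
    pair-product {i} i≢ιi = begin
      orOne x * orOne (enum (ι i))   ≈⟨ *-cong (orOne-nonzero x≉0) (orOne-nonzero gx≉0) ⟩
      x * enum (ι i)                 ≈⟨ *-congˡ (enum-ι i) ⟩
      x * (a * x ⁻¹)                 ≈⟨ solve 3 (λ a x x′ → x :* (a :* x′) := a :* (x :* x′)) refl a x (x ⁻¹) ⟩
      a * (x * x ⁻¹)                 ≈⟨ *-congˡ (⁻¹-inverse x≉0) ⟩
      a * 1#                         ≈⟨ *-identityʳ a ⟩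
      a                              ∎
      where
      x : Carrier
      x = enum i
      x≉0 : x ≉ 0#
      x≉0 x≈0 = i≢ιi (fixes (trans (g-zero x≈0) (sym x≈0)))
      gx≉0 : enum (ι i) ≉ 0#
      gx≉0 = *-nonzero a≉0 (⁻¹-nonzero x≉0) ∘ trans (sym (enum-ι i))

    ∏nonzero-pairs : ∏nonzero ≈ Π.sum (λ i → Π.when (leads i) a)
                               * Π.sum (λ i → Π.when (fixed i) (orOne (enum i)))
    ∏nonzero-pairs = trans (sum-involution *-commutativeMonoid (orOne ∘ enum))
      (*-congʳ (Π.sum-cong-≋ λ i → Π.when-cong (i Fin.<? ι i) (pair-product ∘ Fin.<⇒≢)))

  wilson : ∏nonzero ≈ - 1#
  wilson = begin
    ∏nonzero
      ≈⟨ ∏nonzero-pairs ⟩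
    Π.sum (λ i → Π.when (leads i) 1#) * Π.sum (λ i → Π.when (fixed i) (orOne (enum i)))
      ≈⟨ *-cong (trans (Π.sum-cong-≋ (Π.when-ε ∘ leads)) (Π.sum-replicate-zero q))
                (trans (Π.sum-cong-≋ fixed-part) (Π.sum-when-≟ (index (- 1#)) (- 1#))) ⟩
    1# * - 1#
      ≈⟨ *-identityˡ _ ⟩
    - 1#
      ∎
    where
    open Reciprocal 1# 1≉0

    g-1 : g (- 1#) ≈ - 1#
    g-1 = trans (*-identityˡ _) (⁻¹-unique -1*-1)

    fixed-part : ∀ i → Π.when (does (i Fin.≟ ι i)) (orOne (enum i))
                       ≈ Π.when (does (i Fin.≟ index (- 1#))) (- 1#)
    fixed-part i with i Fin.≟ ι i | i Fin.≟ index (- 1#)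
    ... | yes _    | yes i≡ = trans (orOne-nonzero (-1≉0 ∘ trans (sym (enum-index≡ i≡)))) (enum-index≡ i≡)
    ... | yes i≡ιi | no i≢  = by-cases (enum i ≟ 0#)
      where
      by-cases : Dec (enum i ≈ 0#) → orOne (enum i) ≈ 1#
      by-cases (yes x≈0) = orOne-zero x≈0
      by-cases (no x≉0)  with square-one (root x≉0 (unmoved i≡ιi))
      ... | inj₁ x≈1  = trans (orOne-nonzero x≉0) x≈1
      ... | inj₂ x≈-1 = contradiction (≡.trans (≡.sym (index-enum i)) (index-cong x≈-1)) i≢
    ... | no i≢ιi  | yes i≡ =
      contradiction (fixes (trans (*-congˡ (⁻¹-cong (enum-index≡ i≡))) (trans g-1 (sym (enum-index≡ i≡))))) i≢ιi
    ... | no _     | no _   = refl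

  -1^even : ∀ k → (k ℕ.* 2 ℕ.+ 1) % 4 ≡ 1 → k Π.× (- 1#) ≈ 1#
  -1^even zero          _ = refl
  -1^even (suc zero)    ()
  -1^even (suc (suc k)) k≡ = begin
    - 1# * (- 1# * k Π.× (- 1#))   ≈⟨ *-congˡ (*-congˡ (-1^even k k≡′)) ⟩
    - 1# * (- 1# * 1#)             ≈⟨ trans (*-congˡ (*-identityʳ _)) -1*-1 ⟩
    1#                             ∎
    where
    k≡′ : (k ℕ.* 2 ℕ.+ 1) % 4 ≡ 1
    k≡′ = ≡.trans (≡.sym (%-remove-+ˡ (k ℕ.* 2 ℕ.+ 1) (divides-refl 1))) k≡

  √-1 : q % 2 ≡ 1 → q % 4 ≡ 1 → ∃ λ i → i * i ≈ - 1#
  √-1 q-odd q≡1 with Fin.any? (λ j → enum j * enum j ≟ - 1#)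
  ... | yes (j , jj≈-1) = enum j , jj≈-1
  ... | no ∄root        = contradiction (trans (+-congʳ 1≈-1) (-‿inverseˡ 1#)) (two≉0 q-odd)
    where
    open Reciprocal (- 1#) -1≉0

    only-zero-fixed : ∀ {i} → i ≡ ι i → enum i ≈ 0#
    only-zero-fixed {i} i≡ιi = by-cases (enum i ≟ 0#)
      where
      by-cases : Dec (enum i ≈ 0#) → enum i ≈ 0#
      by-cases (yes x≈0) = x≈0
      by-cases (no x≉0)  = contradiction (i , root x≉0 (unmoved i≡ιi)) ∄root

    zero-fixed : ∀ i → Σℕ.when (does (i Fin.≟ ι i)) 1 ≡ Σℕ.when (does (i Fin.≟ index 0#)) 1
    zero-fixed i with i Fin.≟ ι i | i Fin.≟ index 0#
    ... | yes _    | yes _  = ≡.refl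
    ... | yes i≡ιi | no i≢  = contradiction (≡.trans (≡.sym (index-enum i)) (index-cong (only-zero-fixed i≡ιi))) i≢
    ... | no i≢ιi  | yes i≡ = contradiction (fixes (trans (g-zero (enum-index≡ i≡)) (sym (enum-index≡ i≡)))) i≢ιi
    ... | no _     | no _   = ≡.refl

    fixed-part : Π.sum (λ i → Π.when (fixed i) (orOne (enum i))) ≈ 1#
    fixed-part = trans (Π.sum-cong-≋ λ i → trans (Π.when-cong (i Fin.≟ ι i) (orOne-zero ∘ only-zero-fixed))
                                                  (Π.when-ε _))
                       (Π.sum-replicate-zero q)

    q≡ : q ≡ count leads ℕ.* 2 ℕ.+ 1
    q≡ = ≡.trans card-involution
           (≡.cong (count leads ℕ.* 2 ℕ.+_) (≡.trans (Σℕ.sum-cong-≋ zero-fixed) (Σℕ.sum-when-≟ (index 0#) 1)))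

    1≈-1 : 1# ≈ - 1#
    1≈-1 = begin
      1#
        ≈⟨ -1^even (count leads) (≡.trans (≡.cong (_% 4) (≡.sym q≡)) q≡1) ⟨
      count leads Π.× (- 1#)
        ≈⟨ *-identityʳ _ ⟨
      count leads Π.× (- 1#) * 1#
        ≈⟨ *-cong (Π.sum-when leads (- 1#)) fixed-part ⟨
      Π.sum (λ i → Π.when (leads i) (- 1#)) * Π.sum (λ i → Π.when (fixed i) (orOne (enum i)))
        ≈⟨ ∏nonzero-pairs ⟨
      ∏nonzero
        ≈⟨ wilson ⟩
      - 1#
        ∎

module PartialSums {a ℓ : Level} (G : AbelianGroup a ℓ) where
  open import Data.Product using (_×_)
  open AbelianGroup G renaming (_∙_ to _+_; ε to 0#; _⁻¹ to -_)
  open import Algebra.Properties.CommutativeMonoid.Sum commutativeMonoid using (sum)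
  open import Algebra.Properties.Group group using (inverseʳ-unique)
  open import Algebra.Properties.AbelianGroup G using (xyx⁻¹≈y)
  open import Relation.Binary.Reasoning.Setoid setoid

  next-cases : ∀ {m} (k : Fin (suc m)) →
               (∃ λ j → k ≡ inject₁ j × next k ≡ suc j) ⊎ (k ≡ fromℕ m × next k ≡ zero)
  next-cases {m} k with toℕ k ℕ.<? m
  ... | yes k<m = inj₁ (fromℕ< k<m , Fin.toℕ-injective toℕ-k , ≡.refl)
    where
    toℕ-k : toℕ k ≡ toℕ (inject₁ (fromℕ< k<m))
    toℕ-k = ≡.sym (≡.trans (Fin.toℕ-inject₁ _) (Fin.toℕ-fromℕ< k<m))
  ... | no k≮m  = inj₂ (Fin.toℕ-injective toℕ-k , ≡.refl)
    where
    toℕ-k : toℕ k ≡ toℕ (fromℕ m)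
    toℕ-k = ≡.trans (ℕ.≤∧≮⇒≡ (ℕ.s≤s⁻¹ (Fin.toℕ<n k)) k≮m) (≡.sym (Fin.toℕ-fromℕ m))

  partialSum : ∀ {n} → (Fin n → Carrier) → Fin n → Carrier
  partialSum s zero    = 0#
  partialSum s (suc k) = s zero + partialSum (s ∘ suc) k

  partialSum-suc : ∀ {n} (s : Fin (suc n) → Carrier) k →
                   partialSum s (suc k) ≈ partialSum s (inject₁ k) + s (inject₁ k)
  partialSum-suc s zero    = trans (identityʳ _) (sym (identityˡ _))
  partialSum-suc s (suc k) = trans (∙-congˡ (partialSum-suc (s ∘ suc) k)) (sym (assoc _ _ _))

  partialSum-last : ∀ {n} (s : Fin (suc n) → Carrier) → partialSum s (fromℕ n) + s (fromℕ n) ≈ sum s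
  partialSum-last {zero}  s = comm 0# (s zero)
  partialSum-last {suc n} s = trans (assoc _ _ _) (∙-congˡ (partialSum-last (s ∘ suc)))

  partialSum-next : ∀ {n} (s : Fin n → Carrier) → sum s ≈ 0# → ∀ k → partialSum s (next k) + - partialSum s k ≈ s k
  partialSum-next {suc m} s Σs≈0 k with next-cases k
  ... | inj₁ (j , ≡.refl , next≡) rewrite next≡ = begin
    partialSum s (suc j) + - partialSum s (inject₁ j)                         ≈⟨ ∙-congʳ (partialSum-suc s j) ⟩
    (partialSum s (inject₁ j) + s (inject₁ j)) + - partialSum s (inject₁ j)   ≈⟨ xyx⁻¹≈y _ _ ⟩
    s (inject₁ j)                                                             ∎
  ... | inj₂ (≡.refl , next≡) rewrite next≡ =
    trans (identityˡ _) (sym (inverseʳ-unique _ _ (trans (partialSum-last s) Σs≈0)))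

module Paths {c ℓ : Level} (F : CommutativeRing c ℓ) where
  open CommutativeRing F
  open RingSolver F

  -- Path xs u v: a polygonal path whose successive sides have quadrances xs and whose total
  -- displacement is (u , v), all in null coordinates: the side (d , e) has quadrance d * e.
  data Path : List Carrier → Carrier → Carrier → Set (c ⊔ ℓ) where
    []   : ∀ {u v} → u ≈ 0# → v ≈ 0# → Path [] u v
    step : ∀ {x xs u v} d e → d * e ≈ x → Path xs (u - d) (v - e) → Path (x ∷ xs) u v

  Path-cong : ∀ {xs u u′ v v′} → u ≈ u′ → v ≈ v′ → Path xs u v → Path xs u′ v′
  Path-cong u≈u′ v≈v′ ([] u≈0 v≈0)     = [] (trans (sym u≈u′) u≈0) (trans (sym v≈v′) v≈0)
  Path-cong u≈u′ v≈v′ (step d e de≈x p) = step d e de≈x (Path-cong (+-congʳ u≈u′) (+-congʳ v≈v′) p)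

  side : ∀ {x d e} → d * e ≈ x → Path [ x ] d e
  side {d = d} {e} de≈x = step d e de≈x ([] (-‿inverseʳ d) (-‿inverseʳ e))

  infixr 5 _++ₚ_
  _++ₚ_ : ∀ {xs ys u v u′ v′} → Path xs u v → Path ys u′ v′ → Path (xs ++ ys) (u + u′) (v + v′)
  [] u≈0 v≈0 ++ₚ q = Path-cong (0+ u≈0) (0+ v≈0) q
    where
    0+ : ∀ {a b} → a ≈ 0# → b ≈ a + b
    0+ a≈0 = sym (trans (+-congʳ a≈0) (+-identityˡ _))
  _++ₚ_ {u′ = u′} {v′ = v′} (step {u = u} {v} d e de≈x p) q =
    step d e de≈x (Path-cong (shift u d u′) (shift v e v′) (p ++ₚ q))
    where
    shift : ∀ a b c → (a - b) + c ≈ (a + c) - b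
    shift = solve 3 (λ a b c → (a :- b) :+ c := (a :+ c) :- b) refl

  scale : ∀ {xs u v μ ν} → μ * ν ≈ 1# → Path xs u v → Path xs (μ * u) (ν * v)
  scale {μ = μ} {ν} μν≈1 ([] u≈0 v≈0) = [] (trans (*-congˡ u≈0) (zeroʳ μ)) (trans (*-congˡ v≈0) (zeroʳ ν))
  scale {x ∷ _} {u} {v} {μ} {ν} μν≈1 (step d e de≈x p) =
    step (μ * d) (ν * e) quadrance≈ (Path-cong (*-distribˡ-sub μ u d) (*-distribˡ-sub ν v e) (scale μν≈1 p))
    where
    *-distribˡ-sub : ∀ a b c → a * (b - c) ≈ a * b - a * c
    *-distribˡ-sub = solve 3 (λ a b c → a :* (b :- c) := a :* b :- a :* c) refl
    quadrance≈ : (μ * d) * (ν * e) ≈ x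
    quadrance≈ = trans (solve 4 (λ μ ν d e → (μ :* d) :* (ν :* e) := (μ :* ν) :* (d :* e)) refl μ ν d e)
                       (trans (*-cong μν≈1 de≈x) (*-identityˡ x))

  reorder : ∀ {xs ys u v} → xs ↭ ys → Path xs u v → Path ys u v
  reorder ↭.refl                p                 = p
  reorder (↭.prep x xs↭ys)      (step d e de≈x p) = step d e de≈x (reorder xs↭ys p)
  reorder (↭.swap x y xs↭ys)    (step d e de≈x (step d′ e′ d′e′≈y p)) =
    step d′ e′ d′e′≈y (step d e de≈x (Path-cong (swap-sub _ d d′) (swap-sub _ e e′) (reorder xs↭ys p)))
    where
    swap-sub : ∀ a b c → (a - b) - c ≈ (a - c) - b
    swap-sub = solve 3 (λ a b c → (a :- b) :- c := (a :- c) :- b) refl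
  reorder (↭.trans xs↭ys ys↭zs) p                 = reorder ys↭zs (reorder xs↭ys p)

  rescale : ∀ {x xs u v} → All (_≈ x) xs → Path (replicate (length xs) 1#) u v → Path xs u (x * v)
  rescale {x} [] ([] u≈0 v≈0) = [] u≈0 (trans (*-congˡ v≈0) (zeroʳ x))
  rescale {x} {y ∷ _} {v = v} (y≈x ∷ xs≈x) (step d e de≈1 p) =
    step d (x * e) quadrance≈ (Path-cong refl (solve 3 (λ x v e → x :* (v :- e) := x :* v :- x :* e) refl x v e)
                                              (rescale xs≈x p))
    where
    quadrance≈ : d * (x * e) ≈ y
    quadrance≈ = trans (solve 3 (λ x d e → d :* (x :* e) := x :* (d :* e)) refl x d e)
                       (trans (*-congˡ de≈1) (trans (*-identityʳ x) (sym y≈x)))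

  module Closed (isField : IsField F) (_≟_ : Decidable _≈_) (two≉0 : 1# + 1# ≉ 0#)
                (i : Carrier) (i*i≈-1 : i * i ≈ - 1#) where
    open import Data.Product using (_×_)
    open IsField isField
    open import Relation.Binary.Reasoning.Setoid setoid
    open import Algebra.Properties.Group +-group using (x∙y⁻¹≈ε⇒x≈y)
    open import Algebra.Properties.Ring ring using (-1*x≈-x; -‿involutive)
    open import Algebra.Properties.CommutativeMonoid.Sum +-commutativeMonoid using (sum)
    open PartialSums +-abelianGroup using (partialSum; partialSum-next)

    two : Carrier
    two = 1# + 1#

    half : Carrier
    half = proj₁ (inverse two two≉0)

    -- Identities that hold only modulo a relation r ≈ 0 (such as i * i + 1 or two * half - 1)
    -- are checked by the solver in the form lhs = rhs + c * r.
    modulo : ∀ {lhs rhs c r} → r ≈ 0# → lhs ≈ rhs + c * r → lhs ≈ rhs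
    modulo r≈0 eq = trans eq (trans (+-congˡ (trans (*-congˡ r≈0) (zeroʳ _))) (+-identityʳ _))

    unit-relation : ∀ {x y} → x * y ≈ 1# → x * y - 1# ≈ 0#
    unit-relation xy≈1 = trans (+-congʳ xy≈1) (-‿inverseʳ 1#)

    2h-1≈0 : two * half - 1# ≈ 0#
    2h-1≈0 = unit-relation (proj₂ (inverse two two≉0))

    ii+1≈0 : i * i + 1# ≈ 0#
    ii+1≈0 = trans (+-congʳ i*i≈-1) (-‿inverseˡ 1#)

    pair : ∀ x y → Path (x ∷ y ∷ []) 0# (x - y)
    pair x y = Path-cong (-‿inverseʳ 1#) refl (side (*-identityˡ x) ++ₚ side -1*-y≈y)
      where
      -1*-y≈y : - 1# * - y ≈ y
      -1*-y≈y = solve 1 (λ y → :- κ 1 :* :- y := y) refl y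

    Nondegenerate : List Carrier → Set (c ⊔ ℓ)
    Nondegenerate xs = ∃ λ τ → τ ≉ 0# × Path xs 0# τ

    -- Rescale the first path by (-τ/σ , -σ/τ) so that the second coordinates cancel.
    close : ∀ {xs ys} → Nondegenerate xs → Nondegenerate ys → Path (xs ++ ys) 0# 0#
    close (τ , τ≉0 , p) (σ , σ≉0 , q) = Path-cong u≈0 v≈0 (scale μν≈1 p ++ₚ q)
      where
      τ′ σ′ : Carrier
      τ′ = proj₁ (inverse τ τ≉0)
      σ′ = proj₁ (inverse σ σ≉0)
      T : τ * τ′ - 1# ≈ 0#
      T = unit-relation (proj₂ (inverse τ τ≉0))
      S : σ * σ′ - 1# ≈ 0#
      S = unit-relation (proj₂ (inverse σ σ≉0))
      μν≈1 : - (τ * σ′) * - (σ * τ′) ≈ 1#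
      μν≈1 = modulo S (modulo T (solve 4 (λ τ τ′ σ σ′ → :- (τ :* σ′) :* :- (σ :* τ′)
               := (κ 1 :+ κ 1 :* (σ :* σ′ :- κ 1)) :+ (σ :* σ′) :* (τ :* τ′ :- κ 1)) refl τ τ′ σ σ′))
      u≈0 : - (τ * σ′) * 0# + 0# ≈ 0#
      u≈0 = solve 2 (λ τ σ′ → :- (τ :* σ′) :* κ 0 :+ κ 0 := κ 0) refl τ σ′
      v≈0 : - (σ * τ′) * τ + σ ≈ 0#
      v≈0 = modulo T (solve 3 (λ τ τ′ σ → :- (σ :* τ′) :* τ :+ σ := κ 0 :+ :- σ :* (τ :* τ′ :- κ 1))
                              refl τ τ′ σ)

    unitPath : ∀ x xs → ∃ λ v → Path (x ∷ xs) 1# v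
    unitPath x []       = x , side (*-identityˡ x)
    unitPath x (y ∷ ys) =
      half * x - v , Path-cong 2-1≈1 (+-congˡ (-1*x≈-x v)) (side 2*[h*x]≈x ++ₚ scale -1*-1≈1 p)
      where
      v : Carrier
      v = proj₁ (unitPath y ys)
      p : Path (y ∷ ys) 1# v
      p = proj₂ (unitPath y ys)
      2-1≈1 : two + - 1# * 1# ≈ 1#
      2-1≈1 = solve 0 (κ 2 :+ :- κ 1 :* κ 1 := κ 1) refl
      -1*-1≈1 : - 1# * - 1# ≈ 1#
      -1*-1≈1 = solve 0 (:- κ 1 :* :- κ 1 := κ 1) refl
      2*[h*x]≈x : two * (half * x) ≈ x
      2*[h*x]≈x = modulo 2h-1≈0 (solve 2 (λ h x → κ 2 :* (h :* x) := x :+ x :* (κ 2 :* h :- κ 1)) refl half x)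

    -- Prepending two sides with first coordinates t + s = -1 to a path of first displacement 1
    -- balances it.  For (t , s) = (1 , -2), (i , -1 - i), (-i , -1 + i) the second displacements
    -- satisfy E₂ + E₃ - 2 E₁ = -2 y, so one of them is nonzero.
    nondegenerate : ∀ {ys} → All (_≉ 0#) ys → 3 ≤ length ys → Nondegenerate ys
    nondegenerate {y ∷ z ∷ w ∷ ws} (y≉0 ∷ _) _ = by-cases (E₁ ≟ 0#) (E₂ ≟ 0#) (E₃ ≟ 0#)
      where
      π : Carrier
      π = proj₁ (unitPath w ws)

      prepend : ∀ t t′ s s′ → t * t′ ≈ 1# → s * s′ ≈ 1# → t + s ≈ - 1# →
                Path (y ∷ z ∷ w ∷ ws) 0# (t′ * y + (s′ * z + π))
      prepend t t′ s s′ tt′≈1 ss′≈1 t+s≈-1 =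
        Path-cong balanced refl (side (cancel tt′≈1) ++ₚ side (cancel ss′≈1) ++ₚ proj₂ (unitPath w ws))
        where
        cancel : ∀ {a a′ x} → a * a′ ≈ 1# → a * (a′ * x) ≈ x
        cancel {a} {a′} {x} aa′≈1 = trans (sym (*-assoc a a′ x)) (trans (*-congʳ aa′≈1) (*-identityˡ x))
        balanced : t + (s + 1#) ≈ 0#
        balanced = trans (sym (+-assoc t s 1#)) (trans (+-congʳ t+s≈-1) (-‿inverseˡ 1#))

      E₁ E₂ E₃ : Carrier
      E₁ = 1# * y + (- half * z + π)
      E₂ = - i * y + (half * (i - 1#) * z + π)
      E₃ = i * y + (- (half * (1# + i)) * z + π)

      path₁ : Path (y ∷ z ∷ w ∷ ws) 0# E₁
      path₁ = prepend 1# 1# (- two) (- half) (*-identityˡ 1#)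
        (modulo 2h-1≈0 (solve 1 (λ h → :- κ 2 :* :- h := κ 1 :+ κ 1 :* (κ 2 :* h :- κ 1)) refl half))
        (solve 0 (κ 1 :+ :- κ 2 := :- κ 1) refl)

      path₂ : Path (y ∷ z ∷ w ∷ ws) 0# E₂
      path₂ = prepend i (- i) (- 1# - i) (half * (i - 1#))
        (modulo ii+1≈0 (solve 1 (λ i → i :* :- i := κ 1 :+ :- κ 1 :* (i :* i :+ κ 1)) refl i))
        (modulo 2h-1≈0 (modulo ii+1≈0 (solve 2 (λ i h → (:- κ 1 :- i) :* (h :* (i :- κ 1))
           := (κ 1 :+ κ 1 :* (κ 2 :* h :- κ 1)) :+ :- h :* (i :* i :+ κ 1)) refl i half)))
        (solve 1 (λ i → i :+ (:- κ 1 :- i) := :- κ 1) refl i)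

      path₃ : Path (y ∷ z ∷ w ∷ ws) 0# E₃
      path₃ = prepend (- i) i (- 1# + i) (- (half * (1# + i)))
        (modulo ii+1≈0 (solve 1 (λ i → :- i :* i := κ 1 :+ :- κ 1 :* (i :* i :+ κ 1)) refl i))
        (modulo 2h-1≈0 (modulo ii+1≈0 (solve 2 (λ i h → (:- κ 1 :+ i) :* :- (h :* (κ 1 :+ i))
           := (κ 1 :+ κ 1 :* (κ 2 :* h :- κ 1)) :+ :- h :* (i :* i :+ κ 1)) refl i half)))
        (solve 1 (λ i → :- i :+ (:- κ 1 :+ i) := :- κ 1) refl i)

      combination : E₂ + E₃ - two * E₁ ≈ - (two * y)
      combination = solve 5 (λ i h y z π →
        (:- i :* y :+ (h :* (i :- κ 1) :* z :+ π)) :+ (i :* y :+ (:- (h :* (κ 1 :+ i)) :* z :+ π))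
          :- κ 2 :* (κ 1 :* y :+ (:- h :* z :+ π))
        := :- (κ 2 :* y)) refl i half y z π

      y≈0 : E₁ ≈ 0# → E₂ ≈ 0# → E₃ ≈ 0# → y ≈ 0#
      y≈0 E₁≈0 E₂≈0 E₃≈0 = begin
        y                  ≈⟨ modulo 2h-1≈0 (solve 2 (λ h y → y := h :* (κ 2 :* y) :+ :- y :* (κ 2 :* h :- κ 1))
                                                      refl half y) ⟩
        half * (two * y)   ≈⟨ *-congˡ (trans (sym (-‿involutive _)) (-‿cong (trans (sym combination) vanishes))) ⟩
        half * - 0#        ≈⟨ solve 1 (λ h → h :* :- κ 0 := κ 0) refl half ⟩
        0#                 ∎
        where
        vanishes : E₂ + E₃ - two * E₁ ≈ 0#
        vanishes = trans (+-cong (+-cong E₂≈0 E₃≈0) (-‿cong (*-congˡ E₁≈0)))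
                         (solve 0 (κ 0 :+ κ 0 :- κ 2 :* κ 0 := κ 0) refl)

      by-cases : Dec (E₁ ≈ 0#) → Dec (E₂ ≈ 0#) → Dec (E₃ ≈ 0#) → Nondegenerate (y ∷ z ∷ w ∷ ws)
      by-cases (no E₁≉0)  _          _          = E₁ , E₁≉0 , path₁
      by-cases (yes _)    (no E₂≉0)  _          = E₂ , E₂≉0 , path₂
      by-cases (yes _)    (yes _)    (no E₃≉0)  = E₃ , E₃≉0 , path₃
      by-cases (yes E₁≈0) (yes E₂≈0) (yes E₃≈0) = contradiction (y≈0 E₁≈0 E₂≈0 E₃≈0) y≉0
    nondegenerate {_ ∷ []}     _ (s≤s ())
    nondegenerate {_ ∷ _ ∷ []} _ (s≤s (s≤s ()))

    onesPair : Path (1# ∷ 1# ∷ []) 0# 0#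
    onesPair = Path-cong refl (-‿inverseʳ 1#) (pair 1# 1#)

    five : Carrier
    five = 1# + 1# + 1# + 1# + 1#

    -- z = 2, 5, w, 2w, v with w = -2 - i and v = -1 + 3i satisfy Σ z = Σ 10/z = 0 in ℤ[i], and
    -- every z divides 10; so these are units unless 5 = 0, where five sides (1 , 1) suffice.
    quintuple : Path (replicate 5 1#) 0# 0#
    quintuple = by-cases (five ≟ 0#)
      where
      by-cases : Dec (five ≈ 0#) → Path (replicate 5 1#) 0# 0#
      by-cases (yes five≈0) = Path-cong Σ1≈0 Σ1≈0 (side 1*1 ++ₚ side 1*1 ++ₚ side 1*1 ++ₚ side 1*1 ++ₚ side 1*1)
        where
        1*1 : 1# * 1# ≈ 1#
        1*1 = *-identityˡ 1#
        Σ1≈0 : 1# + (1# + (1# + (1# + 1#))) ≈ 0#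
        Σ1≈0 = trans (solve 0 (κ 1 :+ (κ 1 :+ (κ 1 :+ (κ 1 :+ κ 1))) := κ 5) refl) five≈0
      by-cases (no five≉0) =
        Path-cong Σz≈0 Σẑ≈0 (side u₁ ++ₚ side u₂ ++ₚ side u₃ ++ₚ side u₄ ++ₚ side u₅)
        where
        f t w w̄ v v̄ : Carrier
        f = proj₁ (inverse five five≉0)
        t = half * f
        w = - two - i
        w̄ = - two + i
        v = - 1# + (two + 1#) * i
        v̄ = - 1# - (two + 1#) * i

        10t-1≈0 : two * five * t - 1# ≈ 0#
        10t-1≈0 = modulo 2h-1≈0 (modulo (unit-relation (proj₂ (inverse five five≉0)))
          (solve 2 (λ h f → κ 2 :* κ 5 :* (h :* f) :- κ 1
             := (κ 0 :+ (κ 5 :* f) :* (κ 2 :* h :- κ 1)) :+ κ 1 :* (κ 5 :* f :- κ 1)) refl half f))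

        u₁ : two * (t * five) ≈ 1#
        u₁ = modulo 10t-1≈0 (solve 2 (λ h f → κ 2 :* ((h :* f) :* κ 5)
               := κ 1 :+ κ 1 :* (κ 2 :* κ 5 :* (h :* f) :- κ 1)) refl half f)
        u₂ : five * (t * two) ≈ 1#
        u₂ = modulo 10t-1≈0 (solve 2 (λ h f → κ 5 :* ((h :* f) :* κ 2)
               := κ 1 :+ κ 1 :* (κ 2 :* κ 5 :* (h :* f) :- κ 1)) refl half f)
        u₃ : w * (t * (two * w̄)) ≈ 1#
        u₃ = modulo 10t-1≈0 (modulo ii+1≈0 (solve 3 (λ i h f →
               (:- κ 2 :- i) :* ((h :* f) :* (κ 2 :* (:- κ 2 :+ i)))
               := (κ 1 :+ κ 1 :* (κ 2 :* κ 5 :* (h :* f) :- κ 1)) :+ :- (κ 2 :* (h :* f)) :* (i :* i :+ κ 1))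
             refl i half f))
        u₄ : two * w * (t * w̄) ≈ 1#
        u₄ = modulo 10t-1≈0 (modulo ii+1≈0 (solve 3 (λ i h f →
               κ 2 :* (:- κ 2 :- i) :* ((h :* f) :* (:- κ 2 :+ i))
               := (κ 1 :+ κ 1 :* (κ 2 :* κ 5 :* (h :* f) :- κ 1)) :+ :- (κ 2 :* (h :* f)) :* (i :* i :+ κ 1))
             refl i half f))
        u₅ : v * (t * v̄) ≈ 1#
        u₅ = modulo 10t-1≈0 (modulo ii+1≈0 (solve 3 (λ i h f →
               (:- κ 1 :+ κ 3 :* i) :* ((h :* f) :* (:- κ 1 :- κ 3 :* i))
               := (κ 1 :+ κ 1 :* (κ 2 :* κ 5 :* (h :* f) :- κ 1)) :+ :- (κ 9 :* (h :* f)) :* (i :* i :+ κ 1))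
             refl i half f))

        Σz≈0 : two + (five + (w + (two * w + v))) ≈ 0#
        Σz≈0 = solve 1 (λ i → κ 2 :+ (κ 5 :+ ((:- κ 2 :- i) :+ (κ 2 :* (:- κ 2 :- i) :+ (:- κ 1 :+ κ 3 :* i))))
                              := κ 0) refl i
        Σẑ≈0 : t * five + (t * two + (t * (two * w̄) + (t * w̄ + t * v̄))) ≈ 0#
        Σẑ≈0 = solve 2 (λ i t → t :* κ 5 :+ (t :* κ 2 :+ (t :* (κ 2 :* (:- κ 2 :+ i))
                                  :+ (t :* (:- κ 2 :+ i) :+ t :* (:- κ 1 :- κ 3 :* i))))
                                := κ 0) refl i t

    onesPath : ∀ m → Path (replicate (5 ℕ.+ m) 1#) 0# 0#
    onesPath zero          = quintuple
    onesPath (suc zero)    = Path-cong 0+[0+0]≈0 0+[0+0]≈0 (onesPair ++ₚ onesPair ++ₚ onesPair)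
      where
      0+[0+0]≈0 : 0# + (0# + 0#) ≈ 0#
      0+[0+0]≈0 = trans (+-identityˡ _) (+-identityˡ 0#)
    onesPath (suc (suc m)) = Path-cong (+-identityˡ 0#) (+-identityˡ 0#) (onesPair ++ₚ onesPath m)

    equalPath : ∀ {x xs} → All (_≈ x) xs → 5 ≤ length xs → Path xs 0# 0#
    equalPath {x} {xs} xs≈x 5≤ =
      Path-cong refl (zeroʳ x) (rescale xs≈x (≡.subst (λ k → Path (replicate k 1#) 0# 0#) 5+m≡ (onesPath m)))
      where
      m : ℕ
      m = proj₁ (ℕ.m≤n⇒∃[o]m+o≡n 5≤)
      5+m≡ : 5 ℕ.+ m ≡ length xs
      5+m≡ = proj₂ (ℕ.m≤n⇒∃[o]m+o≡n 5≤)

    split-off : ∀ x ys → All (_≈ x) ys ⊎ ∃₂ λ y zs → y ≉ x × ys ↭ y ∷ zs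
    split-off x []       = inj₁ []
    split-off x (y ∷ ys) with y ≟ x | split-off x ys
    ... | no y≉x  | _                              = inj₂ (y , ys , y≉x , ↭-refl)
    ... | yes y≈x | inj₁ ys≈x                      = inj₁ (y≈x ∷ ys≈x)
    ... | yes _   | inj₂ (z , zs , z≉x , ys↭z∷zs) =
      inj₂ (z , y ∷ zs , z≉x , ↭-trans (↭-prep y ys↭z∷zs) (↭-swap y z ↭-refl))

    closedPath : ∀ xs → All (_≉ 0#) xs → 5 ≤ length xs → Path xs 0# 0#
    closedPath (x ∷ xs) (_ ∷ xs≉0) (s≤s 4≤) with split-off x xs
    ... | inj₁ xs≈x                     = equalPath (refl ∷ xs≈x) (s≤s 4≤)
    ... | inj₂ (y , zs , y≉x , xs↭y∷zs) =
      reorder (↭-prep x (↭.↭-sym xs↭y∷zs)) (close (x - y , x-y≉0 , pair x y) (nondegenerate zs≉0 3≤))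
      where
      x-y≉0 : x - y ≉ 0#
      x-y≉0 x-y≈0 = y≉x (sym (x∙y⁻¹≈ε⇒x≈y x y x-y≈0))
      zs≉0 : All (_≉ 0#) zs
      zs≉0 = All.tail (↭.All-resp-↭ xs↭y∷zs xs≉0)
      3≤ : 3 ≤ length zs
      3≤ = ℕ.≤-pred (≡.subst (4 ≤_) (↭.↭-length xs↭y∷zs) 4≤)

    cartesian : Carrier → Carrier → Point F
    cartesian d e = half * (d + e) , half * i * (d - e)

    norm : Point F → Carrier
    norm (x , y) = x * x + y * y

    -- (d + e)² - (d - e)² = 4 d e, and i turns the difference into a sum of squares.
    norm-cartesian : ∀ {d e x} → d * e ≈ x → norm (cartesian d e) ≈ x
    norm-cartesian {d} {e} de≈x = trans (modulo 2h-1≈0 (modulo ii+1≈0 (solve 4 (λ h i d e →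
        (h :* (d :+ e)) :* (h :* (d :+ e)) :+ (h :* i :* (d :- e)) :* (h :* i :* (d :- e))
        := (d :* e :+ (d :* e :* (κ 2 :* h :+ κ 1)) :* (κ 2 :* h :- κ 1))
             :+ (h :* h :* ((d :- e) :* (d :- e))) :* (i :* i :+ κ 1))
        refl half i d e))) de≈x

    sides : ∀ {n} (a : Fin n → Carrier) {u v} → Path (tabulate a) u v →
            ∃ λ (s : Fin n → Point F) → (∀ k → norm (s k) ≈ a k) ×
              sum (proj₁ ∘ s) ≈ half * (u + v) × sum (proj₂ ∘ s) ≈ half * i * (u - v)
    sides {zero} a ([] u≈0 v≈0) =
      (λ ()) , (λ ()) ,
      sym (trans (*-congˡ (+-cong u≈0 v≈0)) (solve 1 (λ h → h :* (κ 0 :+ κ 0) := κ 0) refl half)) ,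
      sym (trans (*-congˡ (+-cong u≈0 (-‿cong v≈0)))
                 (solve 2 (λ h i → h :* i :* (κ 0 :- κ 0) := κ 0) refl half i))
    sides {suc n} a {u} {v} (step d e de≈x p) with sides (a ∘ suc) p
    ... | s , norm≈ , Σx , Σy =
      cartesian d e Vector.∷ s , norms , trans (+-congˡ Σx) Σx≈ , trans (+-congˡ Σy) Σy≈
      where
      norms : ∀ k → norm ((cartesian d e Vector.∷ s) k) ≈ a k
      norms zero    = norm-cartesian de≈x
      norms (suc k) = norm≈ k
      Σx≈ : half * (d + e) + half * ((u - d) + (v - e)) ≈ half * (u + v)
      Σx≈ = solve 5 (λ h d e u v → h :* (d :+ e) :+ h :* ((u :- d) :+ (v :- e)) := h :* (u :+ v))
                    refl half d e u v
      Σy≈ : half * i * (d - e) + half * i * ((u - d) - (v - e)) ≈ half * i * (u - v)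
      Σy≈ = solve 6 (λ h i d e u v → h :* i :* (d :- e) :+ h :* i :* ((u :- d) :- (v :- e)) := h :* i :* (u :- v))
                    refl half i d e u v

    polygon : ∀ {n} (a : Fin n → Carrier) → Path (tabulate a) 0# 0# →
              ∃ λ (A : Fin n → Point F) → ∀ k → quadrance F (A k) (A (next k)) ≈ a k
    polygon a p with sides a p
    ... | s , norm≈ , Σx , Σy = A , λ k →
      trans (+-cong (square (partialSum-next (proj₁ ∘ s) Σx≈0 k)) (square (partialSum-next (proj₂ ∘ s) Σy≈0 k)))
            (norm≈ k)
      where
      A : Fin _ → Point F
      A k = partialSum (proj₁ ∘ s) k , partialSum (proj₂ ∘ s) k
      square : ∀ {x y} → x ≈ y → x * x ≈ y * y
      square x≈y = *-cong x≈y x≈y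
      Σx≈0 : sum (proj₁ ∘ s) ≈ 0#
      Σx≈0 = trans Σx (solve 1 (λ h → h :* (κ 0 :+ κ 0) := κ 0) refl half)
      Σy≈0 : sum (proj₂ ∘ s) ≈ 0#
      Σy≈0 = trans Σy (solve 2 (λ h i → h :* i :* (κ 0 :- κ 0) := κ 0) refl half i)

theorem6 : ∀ {c ℓ : Level} (F : CommutativeRing c ℓ) → IsField F →
    (q : ℕ) → HasSize F q → IsPrimePower q → q % 2 ≡ 1 → q % 4 ≡ 1 →
    (n : ℕ) → 5 ≤ n →
    (a : Fin n → CommutativeRing.Carrier F) →
    (∀ i → ¬ (CommutativeRing._≈_ F (a i) (CommutativeRing.0# F))) →
    ∃ λ (A : Fin n → Point F) →
    ∀ i → CommutativeRing._≈_ F (quadrance F (A i) (A (next i))) (a i)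
theorem6 F isField q size _ q-odd q≡1 n 5≤n a a≉0 =
  polygon a (closedPath (tabulate a) (All.tabulate⁺ a≉0) (≡.subst (5 ≤_) (≡.sym (List.length-tabulate a)) 5≤n))
  where
  open FiniteField F isField size
  open Paths.Closed F isField _≟_ (two≉0 q-odd) (proj₁ (√-1 q-odd q≡1)) (proj₂ (√-1 q-odd q≡1))
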